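{- Let $(a_n)_{n \geq 1}$ be a sequence of complex numbers. For $|q|<1$, \[ \sum_{n=1}^{\infty} a_n \frac{q^{2n-1}}{1-q^{2n-1}} = \frac{1}{(q;q^2)_\infty} \sum_{n=1}^{\infty} \left( \sum_{k=1}^n s_{n,k}\, a_k\right) (-1)^{n-1} q^n, \] where $s_{n,k}$ denotes the number of $(2k-1)$'s in all partitions of $n$ into distinct odd parts.
   Context: For complex $a$ and $|q|<1$, $(a;q)_\infty := \prod_{j \geq 0} (1 - a q^j)$; thus $(q;q^2)_\infty = \prod_{j \geq 0}(1-q^{2j+1})$. The number of $(2k-1)$'s in all partitions of $n$ into distinct odd parts means the total number of occurrences of the part $2k-1$, summed over all partitions of $n$ into distinct odd parts. -}

module Defs where

open import Level using (Level)
open import Algebra.Bundles using (CommutativeRing)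
open import Data.Nat as ℕ using (ℕ; zero; suc; _∸_; _≡ᵇ_; _≟_)
open import Data.Bool using (if_then_else_)
open import Data.List using (List; []; _∷_; map; _++_; foldr; upTo; filter; length)
open import Data.List.Relation.Unary.Any using ()

sublists : List ℕ → List (List ℕ)
sublists []       = [] ∷ []
sublists (x ∷ xs) = map (x ∷_) (sublists xs) ++ sublists xs

sumℕ : List ℕ → ℕ
sumℕ = foldr ℕ._+_ 0

-- the odd numbers 1, 3, ..., 2n-1 (contains every odd number ≤ n)
oddsUpTo : ℕ → List ℕ
oddsUpTo n = map (λ j → suc (2 ℕ.* j)) (upTo n)

distinctOddPartitions : ℕ → List (List ℕ)
distinctOddPartitions n = filter (λ p → sumℕ p ≟ n) (sublists (oddsUpTo n))

occurrences : ℕ → List ℕ → ℕ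
occurrences m p = length (filter (λ x → x ≟ m) p)

s : ℕ → ℕ → ℕ
s n k = sumℕ (map (occurrences (2 ℕ.* k ∸ 1)) (distinctOddPartitions n))

module PowerSeries {c ℓ : Level} (R : CommutativeRing c ℓ) where
  open CommutativeRing R renaming (Carrier to A)

  Series : Set c
  Series = ℕ → A

  sumA : List A → A
  sumA = foldr _+_ 0#

  fromℕ : ℕ → A
  fromℕ zero    = 0#
  fromℕ (suc n) = 1# + fromℕ n

  sign : ℕ → A
  sign zero    = 1#
  sign (suc m) = - sign m

  one : Series
  one zero    = 1#
  one (suc _) = 0#

  X^ : ℕ → Series
  X^ m n = if m ≡ᵇ n then 1# else 0#

  _⊖_ : Series → Series → Series
  (f ⊖ g) n = f n + (- g n)

  mul : Series → Series → Series
  mul f g n = sumA (map (λ i → f i * g (n ∸ i)) (upTo (suc n)))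

  -- multiplicative inverse of a series with constant term 1:
  -- b 0 = 1, b N = - Σ_{i=1}^{N} f i * b (N - i).
  -- invList f N = b N ∷ b (N-1) ∷ ... ∷ b 0
  invList : Series → ℕ → List A
  invList f zero    = 1# ∷ []
  invList f (suc N) =
    let bs = invList f N
    in (- sumA (zipMul (map (λ i → f (suc i)) (upTo (suc N))) bs)) ∷ bs
    where
    zipMul : List A → List A → List A
    zipMul (x ∷ xs) (y ∷ ys) = x * y ∷ zipMul xs ys
    zipMul _        _        = []

  headA : List A → A
  headA []      = 0#
  headA (x ∷ _) = x

  inv : Series → Series
  inv f N = headA (invList f N)

  -- (q;q^2)_∞ = ∏_{j ≥ 0} (1 - q^{2j+1}); its coefficient of q^N equals
  -- that of the finite product over j ≤ N (the remaining factors are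
  -- ≡ 1 mod q^{N+1}).
  partialProd : ℕ → Series
  partialProd N = foldr mul one (map (λ j → one ⊖ X^ (suc (2 ℕ.* j))) (upTo (suc N)))

  qq²∞ : Series
  qq²∞ N = partialProd N N

  -- Σ_{n ≥ 1} a_n q^{2n-1}/(1 - q^{2n-1}); the n-th term has order
  -- 2n-1 ≥ n, so the coefficient of q^N only involves n ≤ N + 1.
  lhsTerm : (ℕ → A) → ℕ → Series
  lhsTerm a n = λ N → a n * mul (X^ (2 ℕ.* n ∸ 1)) (inv (one ⊖ X^ (2 ℕ.* n ∸ 1))) N

  lhs : (ℕ → A) → Series
  lhs a N = sumA (map (λ i → lhsTerm a (suc i) N) (upTo (suc N)))

  inner : (ℕ → A) → ℕ → A
  inner a n = sumA (map (λ i → fromℕ (s n (suc i)) * a (suc i)) (upTo n))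

  rhsSeries : (ℕ → A) → Series
  rhsSeries a zero    = 0#
  rhsSeries a (suc m) = inner a (suc m) * sign m

  rhs : (ℕ → A) → Series
  rhs a = mul (inv qq²∞) (rhsSeries a)

{-# OPTIONS --safe #-}
-- Write L_m = q^m/(1-q^m). Both sides are linear in a, so it suffices to show
-- (q;q²)_∞ · L_{2k-1} = Σ_n s_{n,k} (-1)^{n-1} q^n. The factor 1 - q^{2k-1} occurs exactly once
-- in (q;q²)_∞, so the left side is q^{2k-1} ∏_{j≠k} (1 - q^{2j-1}); expanding this product over
-- subsets gives Σ (-1)^{|S|-1} q^{ΣS}, summed over the sets S of distinct odd parts containing
-- 2k-1, and for odd parts (-1)^{|S|} = (-1)^{ΣS}. The coefficient of q^n only involves the
-- factors with exponent at most n, so every product is handled as a finite one.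
module Submission where

open import Defs
open import Level using (Level)
open import Algebra.Bundles using (CommutativeRing)
open import Data.Nat as ℕ
  using (ℕ; zero; suc; _∸_; _≤_; _<_; z≤n; s≤s; z<s; s<s; s≤s⁻¹; _≟_; _≤?_)
import Data.Nat.Properties as ℕₚ
open import Data.Bool using (true; false; if_then_else_)
open import Data.List using (List; []; _∷_; map; _++_; foldr; upTo; applyUpTo; filter; length)
import Data.List.Properties as List
open import Data.List.Relation.Unary.All as All using (All; []; _∷_)
import Data.List.Relation.Unary.All.Properties as All
open import Data.List.Relation.Unary.AllPairs using ([]; _∷_)
open import Data.List.Relation.Unary.Any using (here; there)
open import Data.List.Membership.Propositional using (_∈_)
open import Data.List.Membership.Propositional.Properties using (∈-applyUpTo⁺)
open import Data.List.Relation.Unary.Unique.Propositional using (Unique)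
import Data.List.Relation.Unary.Unique.Propositional.Properties as Unique
open import Data.Product using (∃; _,_)
open import Function using (_∘_; id; _⇔_; mk⇔)
open import Relation.Nullary using (Dec; yes; no; does; ¬_)
open import Relation.Nullary.Decidable using (does-⇔; dec-false)
open import Relation.Binary.PropositionalEquality as ≡ using (_≡_; _≢_)

odd : ℕ → ℕ
odd j = suc (2 ℕ.* j)

odds : ℕ → List ℕ
odds = applyUpTo odd

oddsUpTo≡odds : ∀ n → oddsUpTo n ≡ odds n
oddsUpTo≡odds = List.map-upTo odd

2*suc∸1≡odd : ∀ i → 2 ℕ.* suc i ∸ 1 ≡ odd i
2*suc∸1≡odd i = ℕₚ.+-suc i (i ℕ.+ 0)

odd-injective : ∀ {i j} → odd i ≡ odd j → i ≡ j
odd-injective {i} {j} 2i+1≡2j+1 = ℕₚ.*-cancelˡ-≡ i j 2 (ℕₚ.suc-injective 2i+1≡2j+1)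

odds-unique : ∀ n → Unique (odds n)
odds-unique n = Unique.applyUpTo⁺₁ odd n (λ i<j _ → ℕₚ.<⇒≢ i<j ∘ odd-injective)

applyUpTo-+ : ∀ {B : Set} (f : ℕ → B) a b →
              applyUpTo f (a ℕ.+ b) ≡ applyUpTo f a ++ applyUpTo (f ∘ (a ℕ.+_)) b
applyUpTo-+ f zero    b = ≡.refl
applyUpTo-+ f (suc a) b = ≡.cong (f 0 ∷_) (applyUpTo-+ (f ∘ suc) a b)

occurrences-∉ : ∀ {m S} → All (m ≢_) S → occurrences m S ≡ 0
occurrences-∉ {m} m∉S = ≡.cong length (List.filter-none (_≟ m) (All.map ≡.≢-sym m∉S))

sum<⇒∉ : ∀ {m} S → sumℕ S < m → All (m ≢_) S
sum<⇒∉ []      _      = []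
sum<⇒∉ (x ∷ S) x+S<m =
  (λ m≡x → ℕₚ.<⇒≢ (ℕₚ.≤-<-trans (ℕₚ.m≤m+n x (sumℕ S)) x+S<m) (≡.sym m≡x)) ∷
  sum<⇒∉ S (ℕₚ.≤-<-trans (ℕₚ.m≤n+m (sumℕ S) x) x+S<m)

module SeriesIdentities {c ℓ : Level} (R : CommutativeRing c ℓ) where
  open CommutativeRing R renaming (Carrier to A)
  open PowerSeries R
  open import Algebra.Properties.Ring ring using (-‿involutive; -0#≈0#; -‿+-comm; -‿distribʳ-*; -1*x≈-x)
  import Algebra.Properties.CommutativeSemigroup as CommutativeSemigroup
  module +-CS = CommutativeSemigroup +-commutativeSemigroup
  module *-CS = CommutativeSemigroup *-commutativeSemigroup
  open import Relation.Binary.Reasoning.Setoid setoid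

  -- Finite sums and the Cauchy product

  ∑< : ℕ → (ℕ → A) → A
  ∑< zero    f = 0#
  ∑< (suc n) f = f 0 + ∑< n (f ∘ suc)

  sumA-map-applyUpTo : ∀ {B : Set} (f : B → A) (g : ℕ → B) n → sumA (map f (applyUpTo g n)) ≡ ∑< n (f ∘ g)
  sumA-map-applyUpTo f g zero    = ≡.refl
  sumA-map-applyUpTo f g (suc n) = ≡.cong (f (g 0) +_) (sumA-map-applyUpTo f (g ∘ suc) n)

  sumA-map-upTo : ∀ (f : ℕ → A) n → sumA (map f (upTo n)) ≡ ∑< n f
  sumA-map-upTo f = sumA-map-applyUpTo f id

  ∑<-cong : ∀ n {f g} → (∀ {i} → i < n → f i ≈ g i) → ∑< n f ≈ ∑< n g
  ∑<-cong zero    f≈g = refl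
  ∑<-cong (suc n) f≈g = +-cong (f≈g z<s) (∑<-cong n (f≈g ∘ s<s))

  ∑<-zero : ∀ n {f} → (∀ i → f i ≈ 0#) → ∑< n f ≈ 0#
  ∑<-zero zero    f≈0 = refl
  ∑<-zero (suc n) f≈0 = trans (+-cong (f≈0 0) (∑<-zero n (f≈0 ∘ suc))) (+-identityʳ 0#)

  ∑<-+ : ∀ n f g → ∑< n (λ i → f i + g i) ≈ ∑< n f + ∑< n g
  ∑<-+ zero    f g = sym (+-identityʳ 0#)
  ∑<-+ (suc n) f g = trans (+-congˡ (∑<-+ n (f ∘ suc) (g ∘ suc))) (+-CS.interchange _ _ _ _)

  ∑<-*ˡ : ∀ n x f → ∑< n (λ i → x * f i) ≈ x * ∑< n f
  ∑<-*ˡ zero    x f = sym (zeroʳ x)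
  ∑<-*ˡ (suc n) x f = trans (+-congˡ (∑<-*ˡ n x (f ∘ suc))) (sym (distribˡ x _ _))

  ∑<-extend : ∀ n d f → (∀ i → n ≤ i → f i ≈ 0#) → ∑< (n ℕ.+ d) f ≈ ∑< n f
  ∑<-extend zero    d f tail≈0 = ∑<-zero d (λ i → tail≈0 i z≤n)
  ∑<-extend (suc n) d f tail≈0 = +-congˡ (∑<-extend n d (f ∘ suc) (λ i n≤i → tail≈0 (suc i) (s≤s n≤i)))

  infix 4 _≐_
  _≐_ : Series → Series → Set ℓ
  f ≐ g = ∀ n → f n ≈ g n

  mul≡∑< : ∀ f g n → mul f g n ≡ ∑< (suc n) (λ i → f i * g (n ∸ i))
  mul≡∑< f g n = sumA-map-upTo (λ i → f i * g (n ∸ i)) (suc n)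

  mul-head : ∀ f g → mul f g 0 ≈ f 0 * g 0
  mul-head f g = +-identityʳ _

  mul-suc : ∀ f g n → mul f g (suc n) ≈ f 0 * g (suc n) + mul (f ∘ suc) g n
  mul-suc f g n = reflexive (≡.trans (mul≡∑< f g (suc n))
                                     (≡.cong (f 0 * g (suc n) +_) (≡.sym (mul≡∑< (f ∘ suc) g n))))

  mul-cong≤ : ∀ n {f f′ g g′} →
              (∀ {i} → i ≤ n → f i ≈ f′ i) → (∀ {i} → i ≤ n → g i ≈ g′ i) → mul f g n ≈ mul f′ g′ n
  mul-cong≤ n {f} {f′} {g} {g′} f≈f′ g≈g′ = begin
    mul f g n
      ≡⟨ mul≡∑< f g n ⟩
    ∑< (suc n) (λ i → f i * g (n ∸ i))
      ≈⟨ ∑<-cong (suc n) (λ {i} i≤n → *-cong (f≈f′ (s≤s⁻¹ i≤n)) (g≈g′ (ℕₚ.m∸n≤m n i))) ⟩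
    ∑< (suc n) (λ i → f′ i * g′ (n ∸ i))
      ≡⟨ mul≡∑< f′ g′ n ⟨
    mul f′ g′ n
      ∎

  mul-cong : ∀ {f f′ g g′} → f ≐ f′ → g ≐ g′ → mul f g ≐ mul f′ g′
  mul-cong f≐f′ g≐g′ n = mul-cong≤ n (λ {i} _ → f≐f′ i) (λ {i} _ → g≐g′ i)

  mul-congˡ : ∀ f {g g′} → g ≐ g′ → mul f g ≐ mul f g′
  mul-congˡ f = mul-cong {f} (λ _ → refl)

  mul-congʳ : ∀ {f f′} g → f ≐ f′ → mul f g ≐ mul f′ g
  mul-congʳ g f≐f′ = mul-cong {g = g} f≐f′ (λ _ → refl)

  mul-zeroˡ : ∀ {f} g → (∀ i → f i ≈ 0#) → ∀ n → mul f g n ≈ 0#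
  mul-zeroˡ {f} g f≈0 n = trans (reflexive (mul≡∑< f g n))
                                (∑<-zero (suc n) (λ i → trans (*-congʳ (f≈0 i)) (zeroˡ (g (n ∸ i)))))

  mul-distribʳ : ∀ f h g n → mul (λ i → f i + h i) g n ≈ mul f g n + mul h g n
  mul-distribʳ f h g n = begin
    mul (λ i → f i + h i) g n
      ≡⟨ mul≡∑< _ g n ⟩
    ∑< (suc n) (λ i → (f i + h i) * g (n ∸ i))
      ≈⟨ ∑<-cong (suc n) (λ {i} _ → distribʳ (g (n ∸ i)) (f i) (h i)) ⟩
    ∑< (suc n) (λ i → f i * g (n ∸ i) + h i * g (n ∸ i))
      ≈⟨ ∑<-+ (suc n) (λ i → f i * g (n ∸ i)) (λ i → h i * g (n ∸ i)) ⟩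
    ∑< (suc n) (λ i → f i * g (n ∸ i)) + ∑< (suc n) (λ i → h i * g (n ∸ i))
      ≡⟨ ≡.cong₂ _+_ (mul≡∑< f g n) (mul≡∑< h g n) ⟨
    mul f g n + mul h g n
      ∎

  mul-*ˡ : ∀ x f g n → mul (λ i → x * f i) g n ≈ x * mul f g n
  mul-*ˡ x f g n = begin
    mul (λ i → x * f i) g n                  ≡⟨ mul≡∑< _ g n ⟩
    ∑< (suc n) (λ i → (x * f i) * g (n ∸ i)) ≈⟨ ∑<-cong (suc n) (λ {i} _ → *-assoc x (f i) (g (n ∸ i))) ⟩
    ∑< (suc n) (λ i → x * (f i * g (n ∸ i))) ≈⟨ ∑<-*ˡ (suc n) x (λ i → f i * g (n ∸ i)) ⟩
    x * ∑< (suc n) (λ i → f i * g (n ∸ i))   ≡⟨ ≡.cong (x *_) (mul≡∑< f g n) ⟨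
    x * mul f g n                            ∎

  mul-negˡ : ∀ f g n → mul (λ i → - f i) g n ≈ - mul f g n
  mul-negˡ f g n = begin
    mul (λ i → - f i) g n       ≈⟨ mul-congʳ g (λ i → sym (-1*x≈-x (f i))) n ⟩
    mul (λ i → - 1# * f i) g n  ≈⟨ mul-*ˡ (- 1#) f g n ⟩
    - 1# * mul f g n            ≈⟨ -1*x≈-x _ ⟩
    - mul f g n                 ∎

  mul-sucʳ : ∀ f g n → mul f g (suc n) ≈ f (suc n) * g 0 + mul f (g ∘ suc) n
  mul-sucʳ f g zero = begin
    f 0 * g 1 + mul (f ∘ suc) g 0   ≈⟨ +-congˡ (mul-head (f ∘ suc) g) ⟩
    f 0 * g 1 + f 1 * g 0           ≈⟨ +-comm _ _ ⟩
    f 1 * g 0 + f 0 * g 1           ≈⟨ +-congˡ (mul-head f (g ∘ suc)) ⟨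
    f 1 * g 0 + mul f (g ∘ suc) 0   ∎
  mul-sucʳ f g (suc n) = begin
    mul f g (suc (suc n))
      ≈⟨ mul-suc f g (suc n) ⟩
    f 0 * g (2 ℕ.+ n) + mul (f ∘ suc) g (suc n)
      ≈⟨ +-congˡ (mul-sucʳ (f ∘ suc) g n) ⟩
    f 0 * g (2 ℕ.+ n) + (f (2 ℕ.+ n) * g 0 + mul (f ∘ suc) (g ∘ suc) n)
      ≈⟨ +-CS.x∙yz≈y∙xz _ _ _ ⟩
    f (2 ℕ.+ n) * g 0 + (f 0 * g (2 ℕ.+ n) + mul (f ∘ suc) (g ∘ suc) n)
      ≈⟨ +-congˡ (mul-suc f (g ∘ suc) n) ⟨
    f (2 ℕ.+ n) * g 0 + mul f (g ∘ suc) (suc n)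
      ∎

  mul-comm : ∀ f g → mul f g ≐ mul g f
  mul-comm f g zero    = trans (mul-head f g) (trans (*-comm _ _) (sym (mul-head g f)))
  mul-comm f g (suc n) = begin
    mul f g (suc n)                      ≈⟨ mul-suc f g n ⟩
    f 0 * g (suc n) + mul (f ∘ suc) g n  ≈⟨ +-cong (*-comm _ _) (mul-comm (f ∘ suc) g n) ⟩
    g (suc n) * f 0 + mul g (f ∘ suc) n  ≈⟨ mul-sucʳ g f n ⟨
    mul g f (suc n)                      ∎

  mul-distribˡ : ∀ f g h n → mul f (λ i → g i + h i) n ≈ mul f g n + mul f h n
  mul-distribˡ f g h n = begin
    mul f (λ i → g i + h i) n  ≈⟨ mul-comm f _ n ⟩
    mul (λ i → g i + h i) f n  ≈⟨ mul-distribʳ g h f n ⟩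
    mul g f n + mul h f n      ≈⟨ +-cong (mul-comm g f n) (mul-comm h f n) ⟩
    mul f g n + mul f h n      ∎

  mul-*ʳ : ∀ x f g n → mul f (λ i → x * g i) n ≈ x * mul f g n
  mul-*ʳ x f g n = begin
    mul f (λ i → x * g i) n  ≈⟨ mul-comm f _ n ⟩
    mul (λ i → x * g i) f n  ≈⟨ mul-*ˡ x g f n ⟩
    x * mul g f n            ≈⟨ *-congˡ (mul-comm g f n) ⟩
    x * mul f g n            ∎

  mul-negʳ : ∀ f g n → mul f (λ i → - g i) n ≈ - mul f g n
  mul-negʳ f g n = trans (mul-comm f _ n) (trans (mul-negˡ g f n) (-‿cong (mul-comm g f n)))

  mul-assoc : ∀ f g h → mul (mul f g) h ≐ mul f (mul g h)
  mul-assoc f g h zero = begin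
    mul (mul f g) h 0    ≈⟨ mul-head (mul f g) h ⟩
    mul f g 0 * h 0      ≈⟨ *-congʳ (mul-head f g) ⟩
    (f 0 * g 0) * h 0    ≈⟨ *-assoc _ _ _ ⟩
    f 0 * (g 0 * h 0)    ≈⟨ *-congˡ (mul-head g h) ⟨
    f 0 * mul g h 0      ≈⟨ mul-head f (mul g h) ⟨
    mul f (mul g h) 0    ∎
  mul-assoc f g h (suc n) = begin
    mul (mul f g) h (suc n)
      ≈⟨ mul-suc (mul f g) h n ⟩
    mul f g 0 * h (suc n) + mul (mul f g ∘ suc) h n
      ≈⟨ +-cong (*-congʳ (mul-head f g)) (mul-congʳ h (mul-suc f g) n) ⟩
    (f 0 * g 0) * h (suc n) + mul (λ i → f 0 * g (suc i) + mul (f ∘ suc) g i) h n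
      ≈⟨ +-congˡ (mul-distribʳ (λ i → f 0 * g (suc i)) (mul (f ∘ suc) g) h n) ⟩
    (f 0 * g 0) * h (suc n) + (mul (λ i → f 0 * g (suc i)) h n + mul (mul (f ∘ suc) g) h n)
      ≈⟨ +-congˡ (+-cong (mul-*ˡ (f 0) (g ∘ suc) h n) (mul-assoc (f ∘ suc) g h n)) ⟩
    (f 0 * g 0) * h (suc n) + (f 0 * mul (g ∘ suc) h n + mul (f ∘ suc) (mul g h) n)
      ≈⟨ trans (+-congʳ (*-assoc _ _ _)) (sym (+-assoc _ _ _)) ⟩
    (f 0 * (g 0 * h (suc n)) + f 0 * mul (g ∘ suc) h n) + mul (f ∘ suc) (mul g h) n
      ≈⟨ +-congʳ (trans (sym (distribˡ _ _ _)) (*-congˡ (sym (mul-suc g h n)))) ⟩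
    f 0 * mul g h (suc n) + mul (f ∘ suc) (mul g h) n
      ≈⟨ mul-suc f (mul g h) n ⟨
    mul f (mul g h) (suc n)
      ∎

  mul-oneˡ : ∀ g → mul one g ≐ g
  mul-oneˡ g zero    = trans (mul-head one g) (*-identityˡ _)
  mul-oneˡ g (suc n) = begin
    mul one g (suc n)               ≈⟨ mul-suc one g n ⟩
    1# * g (suc n) + mul (λ _ → 0#) g n ≈⟨ +-cong (*-identityˡ _) (mul-zeroˡ g (λ _ → refl) n) ⟩
    g (suc n) + 0#                  ≈⟨ +-identityʳ _ ⟩
    g (suc n)                       ∎

  mul-oneʳ : ∀ g → mul g one ≐ g
  mul-oneʳ g n = trans (mul-comm g one n) (mul-oneˡ g n)

  mul-X^-≥ : ∀ m g {n} → m ≤ n → mul (X^ m) g n ≈ g (n ∸ m)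
  mul-X^-≥ zero    g {n}     z≤n       = trans (mul-congʳ g X^0≐one n) (mul-oneˡ g n)
    where
    X^0≐one : X^ 0 ≐ one
    X^0≐one zero    = refl
    X^0≐one (suc _) = refl
  mul-X^-≥ (suc m) g {suc n} (s≤s m≤n) = begin
    mul (X^ (suc m)) g (suc n)     ≈⟨ mul-suc (X^ (suc m)) g n ⟩
    0# * g (suc n) + mul (X^ m) g n ≈⟨ +-cong (zeroˡ _) (mul-X^-≥ m g m≤n) ⟩
    0# + g (n ∸ m)                 ≈⟨ +-identityˡ _ ⟩
    g (n ∸ m)                      ∎

  mul-X^-< : ∀ m g {n} → n < m → mul (X^ m) g n ≈ 0#
  mul-X^-< (suc m) g {zero}  _         = trans (mul-head (X^ (suc m)) g) (zeroˡ _)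
  mul-X^-< (suc m) g {suc n} (s<s n<m) = begin
    mul (X^ (suc m)) g (suc n)     ≈⟨ mul-suc (X^ (suc m)) g n ⟩
    0# * g (suc n) + mul (X^ m) g n ≈⟨ +-cong (zeroˡ _) (mul-X^-< m g n<m) ⟩
    0# + 0#                        ≈⟨ +-identityˡ 0# ⟩
    0#                             ∎

  mul-[1-X^] : ∀ m g n → mul (one ⊖ X^ m) g n ≈ g n + - mul (X^ m) g n
  mul-[1-X^] m g n = begin
    mul (one ⊖ X^ m) g n                ≈⟨ mul-distribʳ one (λ i → - X^ m i) g n ⟩
    mul one g n + mul (λ i → - X^ m i) g n ≈⟨ +-cong (mul-oneˡ g n) (mul-negˡ (X^ m) g n) ⟩
    g n + - mul (X^ m) g n              ∎

  -- Inverses and Lambert terms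

  sumA-zip* : {z : List A → List A → List A} →
              (∀ x xs y ys → z (x ∷ xs) (y ∷ ys) ≡ x * y ∷ z xs ys) → z [] [] ≡ [] →
              ∀ n (u v : ℕ → A) {xs ys} → xs ≡ applyUpTo u n → ys ≡ applyUpTo v n →
              sumA (z xs ys) ≡ ∑< n (λ i → u i * v i)
  sumA-zip* z-∷ z-[] zero    u v ≡.refl ≡.refl = ≡.cong sumA z-[]
  sumA-zip* z-∷ z-[] (suc n) u v ≡.refl ≡.refl =
    ≡.trans (≡.cong sumA (z-∷ (u 0) (applyUpTo (u ∘ suc) n) (v 0) (applyUpTo (v ∘ suc) n)))
            (≡.cong (u 0 * v 0 +_) (sumA-zip* z-∷ z-[] n (u ∘ suc) (v ∘ suc) ≡.refl ≡.refl))

  invList≡ : ∀ f N → invList f N ≡ applyUpTo (λ i → inv f (N ∸ i)) (suc N)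
  invList≡ f zero    = ≡.refl
  invList≡ f (suc N) = ≡.cong (inv f (suc N) ∷_) (invList≡ f N)

  inv-suc : ∀ f N → inv f (suc N) ≡ - mul (f ∘ suc) (inv f) N
  inv-suc f N = ≡.trans (recurrence f N) (≡.cong -_ (≡.sym (mul≡∑< (f ∘ suc) (inv f) N)))
    where
    -- invList's local zipMul cannot be named, so it is reached by abstracting sumA and the
    -- two lists it is applied to; z in sumA-zip* is fixed before that abstraction.
    recurrence : ∀ f N → inv f (suc N) ≡ - ∑< (suc N) (λ i → f (suc i) * inv f (N ∸ i))
    recurrence f N
      with sumA-zip* {z = _} (λ _ _ _ _ → ≡.refl) ≡.refl (suc N) (f ∘ suc) (λ i → inv f (N ∸ i))
    ... | sum-zip with sumA | map (λ i → f (suc i)) (upTo (suc N)) in xs≡ | invList f N in ys≡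
    ... | _ | _ | _ = ≡.cong -_ (sum-zip (≡.trans (≡.sym xs≡) (List.map-upTo (f ∘ suc) (suc N)))
                                          (≡.subst (λ l → l ≡ headA l ∷ _) ys≡ (invList≡ f N)))

  mul-inv : ∀ f → f 0 ≈ 1# → mul f (inv f) ≐ one
  mul-inv f f₀≈1 zero    = trans (mul-head f (inv f)) (trans (*-congʳ f₀≈1) (*-identityˡ 1#))
  mul-inv f f₀≈1 (suc N) = begin
    mul f (inv f) (suc N)
      ≈⟨ mul-suc f (inv f) N ⟩
    f 0 * inv f (suc N) + mul (f ∘ suc) (inv f) N
      ≈⟨ +-congʳ (*-cong f₀≈1 (reflexive (inv-suc f N))) ⟩
    1# * - mul (f ∘ suc) (inv f) N + mul (f ∘ suc) (inv f) N
      ≈⟨ +-congʳ (*-identityˡ _) ⟩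
    - mul (f ∘ suc) (inv f) N + mul (f ∘ suc) (inv f) N
      ≈⟨ -‿inverseˡ _ ⟩
    0#
      ∎

  mul-inv-[1-X^] : ∀ m → mul (one ⊖ X^ (suc m)) (inv (one ⊖ X^ (suc m))) ≐ one
  mul-inv-[1-X^] m = mul-inv (one ⊖ X^ (suc m)) (trans (+-congˡ -0#≈0#) (+-identityʳ 1#))

  lambert : ℕ → Series
  lambert m = mul (X^ m) (inv (one ⊖ X^ m))

  mul-[1-X^]-lambert : ∀ m e →
                       mul (mul (one ⊖ X^ (suc m)) e) (lambert (suc m)) ≐ mul (X^ (suc m)) e
  mul-[1-X^]-lambert m e n = begin
    mul (mul 1-x e) (mul x i) n  ≈⟨ mul-congʳ (mul x i) (mul-comm 1-x e) n ⟩
    mul (mul e 1-x) (mul x i) n  ≈⟨ mul-assoc e 1-x (mul x i) n ⟩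
    mul e (mul 1-x (mul x i)) n  ≈⟨ mul-congˡ e [1-x]x/[1-x]≐x n ⟩
    mul e x n                    ≈⟨ mul-comm e x n ⟩
    mul x e n                    ∎
    where
    x 1-x i : Series
    x   = X^ (suc m)
    1-x = one ⊖ x
    i   = inv 1-x
    [1-x]x/[1-x]≐x : mul 1-x (mul x i) ≐ x
    [1-x]x/[1-x]≐x k = begin
      mul 1-x (mul x i) k  ≈⟨ mul-assoc 1-x x i k ⟨
      mul (mul 1-x x) i k  ≈⟨ mul-congʳ i (mul-comm 1-x x) k ⟩
      mul (mul x 1-x) i k  ≈⟨ mul-assoc x 1-x i k ⟩
      mul x (mul 1-x i) k  ≈⟨ mul-congˡ x (mul-inv-[1-X^] m) k ⟩
      mul x one k          ≈⟨ mul-oneʳ x k ⟩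
      x k                  ∎

  -- Sums over subsets

  sumA-++ : ∀ xs ys → sumA (xs ++ ys) ≈ sumA xs + sumA ys
  sumA-++ []       ys = sym (+-identityˡ _)
  sumA-++ (x ∷ xs) ys = trans (+-congˡ (sumA-++ xs ys)) (sym (+-assoc _ _ _))

  sumA-map-cong : ∀ {B : Set} {F G : B → A} xs → (∀ b → F b ≈ G b) →
                  sumA (map F xs) ≈ sumA (map G xs)
  sumA-map-cong []       F≈G = refl
  sumA-map-cong (x ∷ xs) F≈G = +-cong (F≈G x) (sumA-map-cong xs F≈G)

  sumA-map-zero : ∀ {B : Set} {F : B → A} xs → (∀ b → F b ≈ 0#) → sumA (map F xs) ≈ 0#
  sumA-map-zero []       F≈0 = refl
  sumA-map-zero (x ∷ xs) F≈0 = trans (+-cong (F≈0 x) (sumA-map-zero xs F≈0)) (+-identityʳ 0#)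

  sumA-map-*ˡ : ∀ {B : Set} y (F : B → A) xs →
                sumA (map (λ b → y * F b) xs) ≈ y * sumA (map F xs)
  sumA-map-*ˡ y F []       = sym (zeroʳ y)
  sumA-map-*ˡ y F (x ∷ xs) = trans (+-congˡ (sumA-map-*ˡ y F xs)) (sym (distribˡ y _ _))

  sumA-map-neg : ∀ {B : Set} (F : B → A) xs → sumA (map (λ b → - F b) xs) ≈ - sumA (map F xs)
  sumA-map-neg F []       = sym -0#≈0#
  sumA-map-neg F (x ∷ xs) = trans (+-congˡ (sumA-map-neg F xs)) (-‿+-comm _ _)

  ∑⊆ : List ℕ → (List ℕ → A) → A
  ∑⊆ L F = sumA (map F (sublists L))

  ∑⊆-∷ : ∀ x L F → ∑⊆ (x ∷ L) F ≈ ∑⊆ L (F ∘ (x ∷_)) + ∑⊆ L F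
  ∑⊆-∷ x L F = begin
    sumA (map F (map (x ∷_) (sublists L) ++ sublists L))
      ≡⟨ ≡.cong sumA (List.map-++ F (map (x ∷_) (sublists L)) (sublists L)) ⟩
    sumA (map F (map (x ∷_) (sublists L)) ++ map F (sublists L))
      ≈⟨ sumA-++ (map F (map (x ∷_) (sublists L))) (map F (sublists L)) ⟩
    sumA (map F (map (x ∷_) (sublists L))) + ∑⊆ L F
      ≡⟨ ≡.cong (λ ys → sumA ys + ∑⊆ L F) (List.map-∘ (sublists L)) ⟨
    ∑⊆ L (F ∘ (x ∷_)) + ∑⊆ L F
      ∎

  ∑⊆-congᴬ : ∀ {P : ℕ → Set} {L} → All P L → ∀ {F G} → (∀ {S} → All P S → F S ≈ G S) →
             ∑⊆ L F ≈ ∑⊆ L G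
  ∑⊆-congᴬ []                           F≈G = +-congʳ (F≈G [])
  ∑⊆-congᴬ {L = x ∷ L} (px ∷ pL) {F} {G} F≈G = begin
    ∑⊆ (x ∷ L) F                ≈⟨ ∑⊆-∷ x L F ⟩
    ∑⊆ L (F ∘ (x ∷_)) + ∑⊆ L F  ≈⟨ +-cong (∑⊆-congᴬ pL (F≈G ∘ (px ∷_))) (∑⊆-congᴬ pL F≈G) ⟩
    ∑⊆ L (G ∘ (x ∷_)) + ∑⊆ L G  ≈⟨ ∑⊆-∷ x L G ⟨
    ∑⊆ (x ∷ L) G                ∎

  ∑⊆-large : ∀ {n M} → All (n <_) M → ∀ F → (∀ S → n < sumℕ S → F S ≈ 0#) →
             ∑⊆ M F ≈ ∑⊆ [] F
  ∑⊆-large []                      F large≈0 = refl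
  ∑⊆-large {M = y ∷ M} (y>n ∷ M>n) F large≈0 = begin
    ∑⊆ (y ∷ M) F                ≈⟨ ∑⊆-∷ y M F ⟩
    ∑⊆ M (F ∘ (y ∷_)) + ∑⊆ M F  ≈⟨ +-cong (sumA-map-zero (sublists M) y∷S-large≈0)
                                          (∑⊆-large M>n F large≈0) ⟩
    0# + ∑⊆ [] F                ≈⟨ +-identityˡ _ ⟩
    ∑⊆ [] F                     ∎
    where
    y∷S-large≈0 : ∀ S → F (y ∷ S) ≈ 0#
    y∷S-large≈0 S = large≈0 (y ∷ S) (ℕₚ.<-≤-trans y>n (ℕₚ.m≤m+n y (sumℕ S)))

  ∑⊆-++-large : ∀ {n} L {M} → All (n <_) M → ∀ F → (∀ S → n < sumℕ S → F S ≈ 0#) →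
                ∑⊆ (L ++ M) F ≈ ∑⊆ L F
  ∑⊆-++-large []      M>n F large≈0 = ∑⊆-large M>n F large≈0
  ∑⊆-++-large (x ∷ L) {M} M>n F large≈0 = begin
    ∑⊆ (x ∷ L ++ M) F                         ≈⟨ ∑⊆-∷ x (L ++ M) F ⟩
    ∑⊆ (L ++ M) (F ∘ (x ∷_)) + ∑⊆ (L ++ M) F  ≈⟨ +-cong (∑⊆-++-large L M>n (F ∘ (x ∷_)) x∷S-large≈0)
                                                        (∑⊆-++-large L M>n F large≈0) ⟩
    ∑⊆ L (F ∘ (x ∷_)) + ∑⊆ L F                ≈⟨ ∑⊆-∷ x L F ⟨
    ∑⊆ (x ∷ L) F                              ∎
    where
    x∷S-large≈0 : ∀ S → _ < sumℕ S → F (x ∷ S) ≈ 0#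
    x∷S-large≈0 S n<S = large≈0 (x ∷ S) (ℕₚ.<-≤-trans n<S (ℕₚ.m≤n+m (sumℕ S) x))

  ⟦_⟧ : ∀ {p} {P : Set p} → Dec P → A
  ⟦ P? ⟧ = if does P? then 1# else 0#

  ⟦⟧-⇔ : ∀ {p q} {P : Set p} {Q : Set q} → P ⇔ Q → (P? : Dec P) (Q? : Dec Q) → ⟦ P? ⟧ ≡ ⟦ Q? ⟧
  ⟦⟧-⇔ P⇔Q P? Q? = ≡.cong (λ b → if b then 1# else 0#) (does-⇔ P⇔Q P? Q?)

  ⟦⟧-reject : ∀ {p} {P : Set p} (P? : Dec P) → ¬ P → ⟦ P? ⟧ ≡ 0#
  ⟦⟧-reject P? ¬P = ≡.cong (λ b → if b then 1# else 0#) (dec-false P? ¬P)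

  ⟦⟧*-cong : ∀ {p} {P : Set p} (P? : Dec P) {x y} → (P → x ≈ y) → ⟦ P? ⟧ * x ≈ ⟦ P? ⟧ * y
  ⟦⟧*-cong (yes p) x≈y = *-congˡ (x≈y p)
  ⟦⟧*-cong (no _)  _   = trans (zeroˡ _) (sym (zeroˡ _))

  subsetGF : List ℕ → (List ℕ → A) → Series
  subsetGF L w n = ∑⊆ L (λ S → ⟦ sumℕ S ≟ n ⟧ * w S)

  subsetGF-congᴬ : ∀ {P : ℕ → Set} {L} → All P L → ∀ {w w′} → (∀ {S} → All P S → w S ≈ w′ S) →
                   subsetGF L w ≐ subsetGF L w′
  subsetGF-congᴬ pL w≈w′ n = ∑⊆-congᴬ pL (λ pS → *-congˡ (w≈w′ pS))

  subsetGF-zeroᴬ : ∀ {P : ℕ → Set} {L} → All P L → ∀ {w} → (∀ {S} → All P S → w S ≈ 0#) →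
                   ∀ n → subsetGF L w n ≈ 0#
  subsetGF-zeroᴬ {L = L} pL w≈0 n = trans (∑⊆-congᴬ pL (λ pS → trans (*-congˡ (w≈0 pS)) (zeroʳ _)))
                                          (sumA-map-zero (sublists L) (λ _ → refl))

  subsetGF-neg : ∀ L w n → subsetGF L (λ S → - w S) n ≈ - subsetGF L w n
  subsetGF-neg L w n = trans (sumA-map-cong (sublists L) (λ S → sym (-‿distribʳ-* _ (w S))))
                             (sumA-map-neg (λ S → ⟦ sumℕ S ≟ n ⟧ * w S) (sublists L))

  subsetGF-∷ : ∀ x L w n → subsetGF (x ∷ L) w n ≈ mul (X^ x) (subsetGF L (w ∘ (x ∷_))) n + subsetGF L w n
  subsetGF-∷ x L w n = trans (∑⊆-∷ x L _) (+-congʳ (shifted (x ≤? n)))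
    where
    shifted : Dec (x ≤ n) →
              ∑⊆ L (λ S → ⟦ x ℕ.+ sumℕ S ≟ n ⟧ * w (x ∷ S)) ≈ mul (X^ x) (subsetGF L (w ∘ (x ∷_))) n
    shifted (yes x≤n) = trans (sumA-map-cong (sublists L) (λ S → *-congʳ (reflexive (shift (sumℕ S)))))
                              (sym (mul-X^-≥ x (subsetGF L (w ∘ (x ∷_))) x≤n))
      where
      shift : ∀ t → ⟦ x ℕ.+ t ≟ n ⟧ ≡ ⟦ t ≟ n ∸ x ⟧
      shift t = ⟦⟧-⇔ (mk⇔ (λ x+t≡n → ≡.trans (≡.sym (ℕₚ.m+n∸m≡n x t)) (≡.cong (_∸ x) x+t≡n))
                          (λ t≡n∸x → ≡.trans (≡.cong (x ℕ.+_) t≡n∸x) (ℕₚ.m+[n∸m]≡n x≤n)))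
                     (x ℕ.+ t ≟ n) (t ≟ n ∸ x)
    shifted (no x≰n) = trans (sumA-map-zero (sublists L) (λ S → trans (*-congʳ (reflexive (reject S))) (zeroˡ _)))
                             (sym (mul-X^-< x (subsetGF L (w ∘ (x ∷_))) (ℕₚ.≰⇒> x≰n)))
      where
      reject : ∀ S → ⟦ x ℕ.+ sumℕ S ≟ n ⟧ ≡ 0#
      reject S = ⟦⟧-reject (x ℕ.+ sumℕ S ≟ n)
                           (λ x+S≡n → x≰n (≡.subst (x ≤_) x+S≡n (ℕₚ.m≤m+n x (sumℕ S))))

  subsetGF-∷-alternating : ∀ x L w → (∀ S → w (x ∷ S) ≈ - w S) →
                           subsetGF (x ∷ L) w ≐ mul (one ⊖ X^ x) (subsetGF L w)
  subsetGF-∷-alternating x L w w-alt n = begin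
    subsetGF (x ∷ L) w n                                     ≈⟨ subsetGF-∷ x L w n ⟩
    mul (X^ x) (subsetGF L (w ∘ (x ∷_))) n + subsetGF L w n  ≈⟨ +-congʳ (mul-congˡ (X^ x) tail≐neg n) ⟩
    mul (X^ x) (λ k → - subsetGF L w k) n + subsetGF L w n   ≈⟨ +-congʳ (mul-negʳ (X^ x) (subsetGF L w) n) ⟩
    - mul (X^ x) (subsetGF L w) n + subsetGF L w n           ≈⟨ +-comm _ _ ⟩
    subsetGF L w n + - mul (X^ x) (subsetGF L w) n           ≈⟨ mul-[1-X^] x (subsetGF L w) n ⟨
    mul (one ⊖ X^ x) (subsetGF L w) n                        ∎
    where
    tail≐neg : subsetGF L (w ∘ (x ∷_)) ≐ λ k → - subsetGF L w k
    tail≐neg k = trans (sumA-map-cong (sublists L) (λ S → *-congˡ (w-alt S))) (subsetGF-neg L w k)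

  subsetGF-++-large : ∀ L {M} n w → All (n <_) M → subsetGF (L ++ M) w n ≈ subsetGF L w n
  subsetGF-++-large L n w M>n = ∑⊆-++-large L M>n _
    (λ S n<S → trans (*-congʳ (reflexive (⟦⟧-reject (sumℕ S ≟ n) (ℕₚ.<⇒≢ n<S ∘ ≡.sym)))) (zeroˡ _))

  ∏1-X^ : List ℕ → Series
  ∏1-X^ L = foldr mul one (map (λ x → one ⊖ X^ x) L)

  ∏1-X^≐subsetGF : ∀ L → ∏1-X^ L ≐ subsetGF L (sign ∘ length)
  ∏1-X^≐subsetGF []      zero    = sym (trans (+-identityʳ _) (*-identityˡ 1#))
  ∏1-X^≐subsetGF []      (suc n) = sym (trans (+-identityʳ _) (zeroˡ 1#))
  ∏1-X^≐subsetGF (x ∷ L) n       = begin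
    mul (one ⊖ X^ x) (∏1-X^ L) n
      ≈⟨ mul-congˡ (one ⊖ X^ x) (∏1-X^≐subsetGF L) n ⟩
    mul (one ⊖ X^ x) (subsetGF L (sign ∘ length)) n
      ≈⟨ subsetGF-∷-alternating x L (sign ∘ length) (λ _ → refl) n ⟨
    subsetGF (x ∷ L) (sign ∘ length) n
      ∎

  markedSign : ℕ → List ℕ → A
  markedSign m S = fromℕ (occurrences m S) * sign (suc (length S))

  markedSign-∉ : ∀ {m S} → All (m ≢_) S → markedSign m S ≈ 0#
  markedSign-∉ {m} {S} m∉S = trans (*-congʳ (reflexive (≡.cong fromℕ (occurrences-∉ m∉S)))) (zeroˡ _)

  markedSign-here : ∀ {m S} → All (m ≢_) S → markedSign m (m ∷ S) ≈ sign (length S)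
  markedSign-here {m} {S} m∉S = begin
    fromℕ (occurrences m (m ∷ S)) * - - sign (length S)
      ≡⟨ ≡.cong (λ k → fromℕ k * - - sign (length S)) occurrences≡1 ⟩
    (1# + 0#) * - - sign (length S)
      ≈⟨ *-cong (+-identityʳ 1#) (-‿involutive _) ⟩
    1# * sign (length S)
      ≈⟨ *-identityˡ _ ⟩
    sign (length S)
      ∎
    where
    occurrences≡1 : occurrences m (m ∷ S) ≡ 1
    occurrences≡1 = ≡.trans (≡.cong length (List.filter-accept (_≟ m) ≡.refl))
                            (≡.cong suc (occurrences-∉ m∉S))

  markedSign-there : ∀ {m x} → x ≢ m → ∀ S → markedSign m (x ∷ S) ≈ - markedSign m S
  markedSign-there {m} {x} x≢m S = begin
    fromℕ (occurrences m (x ∷ S)) * - sign (suc (length S))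
      ≡⟨ ≡.cong (λ l → fromℕ (length l) * - sign (suc (length S))) (List.filter-reject (_≟ m) x≢m) ⟩
    fromℕ (occurrences m S) * - sign (suc (length S))
      ≈⟨ -‿distribʳ-* _ _ ⟨
    - markedSign m S
      ∎

  ∏1-X^*lambert : ∀ {m L} → Unique L → suc m ∈ L →
                  mul (∏1-X^ L) (lambert (suc m)) ≐ subsetGF L (markedSign (suc m))
  ∏1-X^*lambert {m} {_ ∷ L} (m∉L ∷ _) (here ≡.refl) n = begin
    mul (mul (one ⊖ X^ m′) (∏1-X^ L)) (lambert m′) n
      ≈⟨ mul-[1-X^]-lambert m (∏1-X^ L) n ⟩
    mul (X^ m′) (∏1-X^ L) n
      ≈⟨ mul-congˡ (X^ m′) (∏1-X^≐subsetGF L) n ⟩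
    mul (X^ m′) (subsetGF L (sign ∘ length)) n
      ≈⟨ mul-congˡ (X^ m′) (subsetGF-congᴬ m∉L (sym ∘ markedSign-here)) n ⟩
    mul (X^ m′) (subsetGF L (markedSign m′ ∘ (m′ ∷_))) n
      ≈⟨ +-identityʳ _ ⟨
    mul (X^ m′) (subsetGF L (markedSign m′ ∘ (m′ ∷_))) n + 0#
      ≈⟨ +-congˡ (subsetGF-zeroᴬ m∉L markedSign-∉ n) ⟨
    mul (X^ m′) (subsetGF L (markedSign m′ ∘ (m′ ∷_))) n + subsetGF L (markedSign m′) n
      ≈⟨ subsetGF-∷ m′ L (markedSign m′) n ⟨
    subsetGF (m′ ∷ L) (markedSign m′) n
      ∎
    where m′ = suc m
  ∏1-X^*lambert {m} {x ∷ L} (x∉L ∷ L-unique) (there m∈L) n = begin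
    mul (mul (one ⊖ X^ x) (∏1-X^ L)) (lambert m′) n
      ≈⟨ mul-assoc (one ⊖ X^ x) (∏1-X^ L) (lambert m′) n ⟩
    mul (one ⊖ X^ x) (mul (∏1-X^ L) (lambert m′)) n
      ≈⟨ mul-congˡ (one ⊖ X^ x) (∏1-X^*lambert L-unique m∈L) n ⟩
    mul (one ⊖ X^ x) (subsetGF L (markedSign m′)) n
      ≈⟨ subsetGF-∷-alternating x L (markedSign m′) (markedSign-there (All.lookup x∉L m∈L)) n ⟨
    subsetGF (x ∷ L) (markedSign m′) n
      ∎
    where m′ = suc m

  -- Partitions into distinct odd parts

  sign-2*+ : ∀ j t → sign (2 ℕ.* j ℕ.+ t) ≈ sign t
  sign-2*+ zero    t = refl
  sign-2*+ (suc j) t = begin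
    sign (2 ℕ.* suc j ℕ.+ t)    ≡⟨ ≡.cong (λ k → sign (k ℕ.+ t)) (ℕₚ.*-suc 2 j) ⟩
    - - sign (2 ℕ.* j ℕ.+ t)    ≈⟨ -‿involutive _ ⟩
    sign (2 ℕ.* j ℕ.+ t)        ≈⟨ sign-2*+ j t ⟩
    sign t                      ∎

  sign-length≈sign-sum : ∀ {S} → All (λ x → ∃ λ j → x ≡ odd j) S → sign (length S) ≈ sign (sumℕ S)
  sign-length≈sign-sum             []                       = refl
  sign-length≈sign-sum {S = _ ∷ S} ((j , ≡.refl) ∷ S-odd) =
    -‿cong (trans (sign-length≈sign-sum S-odd) (sym (sign-2*+ j (sumℕ S))))

  fromℕ-+ : ∀ a b → fromℕ (a ℕ.+ b) ≈ fromℕ a + fromℕ b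
  fromℕ-+ zero    b = sym (+-identityˡ _)
  fromℕ-+ (suc a) b = trans (+-congˡ (fromℕ-+ a b)) (sym (+-assoc _ _ _))

  fromℕ-sum-filter : ∀ {B : Set} {P : B → Set} (P? : ∀ b → Dec (P b)) (f : B → ℕ) xs →
                     fromℕ (sumℕ (map f (filter P? xs))) ≈ sumA (map (λ b → ⟦ P? b ⟧ * fromℕ (f b)) xs)
  fromℕ-sum-filter P? f []       = refl
  fromℕ-sum-filter P? f (x ∷ xs) with does (P? x)
  ... | true  = trans (fromℕ-+ (f x) _) (+-cong (sym (*-identityˡ _)) (fromℕ-sum-filter P? f xs))
  ... | false = trans (fromℕ-sum-filter P? f xs) (sym (trans (+-congʳ (zeroˡ _)) (+-identityˡ _)))

  fromℕ-s : ∀ n i →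
            fromℕ (s n (suc i)) ≈ ∑⊆ (odds n) (λ S → ⟦ sumℕ S ≟ n ⟧ * fromℕ (occurrences (odd i) S))
  fromℕ-s n i =
    trans (fromℕ-sum-filter (λ S → sumℕ S ≟ n) (occurrences (2 ℕ.* suc i ∸ 1)) (sublists (oddsUpTo n)))
          (reflexive (≡.cong₂ (λ L m → ∑⊆ L (λ S → ⟦ sumℕ S ≟ n ⟧ * fromℕ (occurrences m S)))
                              (oddsUpTo≡odds n) (2*suc∸1≡odd i)))

  fromℕ-s-large : ∀ {n i} → n ≤ i → fromℕ (s n (suc i)) ≈ 0#
  fromℕ-s-large {n} {i} n≤i = trans (fromℕ-s n i) (sumA-map-zero (sublists (odds n)) (λ S →
    trans (⟦⟧*-cong (sumℕ S ≟ n) (reflexive ∘ ≡.cong fromℕ ∘ occurrences-∉ ∘ sum<⇒∉ S ∘ sum<odd S))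
          (zeroʳ _)))
    where
    sum<odd : ∀ S → sumℕ S ≡ n → sumℕ S < odd i
    sum<odd S S≡n = s≤s (≡.subst (_≤ 2 ℕ.* i) (≡.sym S≡n) (ℕₚ.≤-trans n≤i (ℕₚ.m≤m+n i (i ℕ.+ 0))))

  sSeries : ℕ → Series
  sSeries i zero    = 0#
  sSeries i (suc n) = fromℕ (s (suc n) (suc i)) * sign n

  subsetGF-odds≈sSeries : ∀ i n → subsetGF (odds n) (markedSign (odd i)) n ≈ sSeries i n
  subsetGF-odds≈sSeries i zero    = trans (+-identityʳ _) (trans (*-identityˡ _) (zeroˡ _))
  subsetGF-odds≈sSeries i (suc n) = begin
    subsetGF (odds (suc n)) (markedSign m) (suc n)
      ≈⟨ ∑⊆-congᴬ odds-odd marked≈signed ⟩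
    ∑⊆ (odds (suc n)) (λ S → sign n * (⟦ sumℕ S ≟ suc n ⟧ * fromℕ (occurrences m S)))
      ≈⟨ sumA-map-*ˡ (sign n) _ (sublists (odds (suc n))) ⟩
    sign n * ∑⊆ (odds (suc n)) (λ S → ⟦ sumℕ S ≟ suc n ⟧ * fromℕ (occurrences m S))
      ≈⟨ *-congˡ (fromℕ-s (suc n) i) ⟨
    sign n * fromℕ (s (suc n) (suc i))
      ≈⟨ *-comm _ _ ⟩
    fromℕ (s (suc n) (suc i)) * sign n
      ∎
    where
    m = odd i
    odds-odd : All (λ x → ∃ λ j → x ≡ odd j) (odds (suc n))
    odds-odd = All.applyUpTo⁺₂ odd (suc n) (λ j → j , ≡.refl)
    marked≈signed : ∀ {S} → All (λ x → ∃ λ j → x ≡ odd j) S →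
                    ⟦ sumℕ S ≟ suc n ⟧ * markedSign m S ≈
                    sign n * (⟦ sumℕ S ≟ suc n ⟧ * fromℕ (occurrences m S))
    marked≈signed {S} S-odd = trans (⟦⟧*-cong (sumℕ S ≟ suc n) (λ S≡1+n → *-congˡ (begin
        - sign (length S)  ≈⟨ -‿cong (sign-length≈sign-sum S-odd) ⟩
        - sign (sumℕ S)    ≡⟨ ≡.cong (λ k → - sign k) S≡1+n ⟩
        - - sign n         ≈⟨ -‿involutive _ ⟩
        sign n             ∎)))
      (*-CS.x∙yz≈z∙xy _ _ _)

  subsetGF-odds-mono : ∀ {n a K} w → n ≤ a → a ≤ K → subsetGF (odds K) w n ≈ subsetGF (odds a) w n
  subsetGF-odds-mono {n} {a} {K} w n≤a a≤K = begin
    subsetGF (odds K) w n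
      ≡⟨ ≡.cong (λ k → subsetGF (odds k) w n) (ℕₚ.m+[n∸m]≡n a≤K) ⟨
    subsetGF (odds (a ℕ.+ (K ∸ a))) w n
      ≡⟨ ≡.cong (λ L → subsetGF L w n) (applyUpTo-+ odd a (K ∸ a)) ⟩
    subsetGF (odds a ++ applyUpTo (odd ∘ (a ℕ.+_)) (K ∸ a)) w n
      ≈⟨ subsetGF-++-large (odds a) n w (All.applyUpTo⁺₂ _ (K ∸ a) n<odd) ⟩
    subsetGF (odds a) w n
      ∎
    where
    n<odd : ∀ j → n < odd (a ℕ.+ j)
    n<odd j = s≤s (ℕₚ.≤-trans n≤a (ℕₚ.≤-trans (ℕₚ.m≤m+n a j) (ℕₚ.m≤m+n (a ℕ.+ j) _)))

  partialProd≡∏odds : ∀ N → partialProd N ≡ ∏1-X^ (odds (suc N))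
  partialProd≡∏odds N = ≡.cong (foldr mul one)
    (≡.trans (List.map-upTo (λ j → one ⊖ X^ (odd j)) (suc N))
             (≡.sym (List.map-applyUpTo odd (λ x → one ⊖ X^ x) (suc N))))

  qq²∞≈∏odds : ∀ {j K} → j < K → qq²∞ j ≈ ∏1-X^ (odds K) j
  qq²∞≈∏odds {j} {K} j<K = begin
    qq²∞ j                                   ≡⟨ ≡.cong (λ P → P j) (partialProd≡∏odds j) ⟩
    ∏1-X^ (odds (suc j)) j                   ≈⟨ ∏1-X^≐subsetGF (odds (suc j)) j ⟩
    subsetGF (odds (suc j)) (sign ∘ length) j ≈⟨ subsetGF-odds-mono (sign ∘ length) (ℕₚ.n≤1+n j) j<K ⟨
    subsetGF (odds K) (sign ∘ length) j       ≈⟨ ∏1-X^≐subsetGF (odds K) j ⟨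
    ∏1-X^ (odds K) j                         ∎

  qq²∞*lambert : ∀ i → mul qq²∞ (lambert (odd i)) ≐ sSeries i
  qq²∞*lambert i n = begin
    mul qq²∞ (lambert (odd i)) n
      ≈⟨ mul-cong≤ n {g = lambert (odd i)} (λ j≤n → qq²∞≈∏odds (s≤s (ℕₚ.≤-trans j≤n n≤n+i))) (λ _ → refl) ⟩
    mul (∏1-X^ (odds K)) (lambert (odd i)) n
      ≈⟨ ∏1-X^*lambert (odds-unique K) (∈-applyUpTo⁺ odd (s≤s (ℕₚ.m≤n+m i n))) n ⟩
    subsetGF (odds K) (markedSign (odd i)) n
      ≈⟨ subsetGF-odds-mono (markedSign (odd i)) ℕₚ.≤-refl (ℕₚ.m≤n⇒m≤1+n n≤n+i) ⟩
    subsetGF (odds n) (markedSign (odd i)) n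
      ≈⟨ subsetGF-odds≈sSeries i n ⟩
    sSeries i n
      ∎
    where
    K = suc (n ℕ.+ i)
    n≤n+i = ℕₚ.m≤m+n n i

  qq²∞₀≈1 : qq²∞ 0 ≈ 1#
  qq²∞₀≈1 = trans (mul-head (one ⊖ X^ 1) one)
                  (trans (*-identityʳ _) (trans (+-congˡ -0#≈0#) (+-identityʳ 1#)))

  lambert≐inv*sSeries : ∀ i → lambert (odd i) ≐ mul (inv qq²∞) (sSeries i)
  lambert≐inv*sSeries i n = sym (begin
    mul (inv qq²∞) (sSeries i) n                 ≈⟨ mul-congˡ (inv qq²∞) (sym ∘ qq²∞*lambert i) n ⟩
    mul (inv qq²∞) (mul qq²∞ (lambert (odd i))) n ≈⟨ mul-assoc (inv qq²∞) qq²∞ (lambert (odd i)) n ⟨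
    mul (mul (inv qq²∞) qq²∞) (lambert (odd i)) n ≈⟨ mul-congʳ (lambert (odd i)) inv*qq²∞≐one n ⟩
    mul one (lambert (odd i)) n                  ≈⟨ mul-oneˡ (lambert (odd i)) n ⟩
    lambert (odd i) n                            ∎)
    where
    inv*qq²∞≐one : mul (inv qq²∞) qq²∞ ≐ one
    inv*qq²∞≐one k = trans (mul-comm (inv qq²∞) qq²∞ k) (mul-inv qq²∞ qq²∞₀≈1 k)

  lhs≈∑< : ∀ a N → lhs a N ≈ ∑< (suc N) (λ i → a (suc i) * lambert (odd i) N)
  lhs≈∑< a N = trans (reflexive (sumA-map-upTo (λ i → lhsTerm a (suc i) N) (suc N)))
    (∑<-cong (suc N) (λ {i} _ → reflexive (≡.cong (λ m → a (suc i) * lambert m N) (2*suc∸1≡odd i))))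

  rhsSeries≈∑< : ∀ a {n N} → n ≤ N → rhsSeries a n ≈ ∑< (suc N) (λ i → a (suc i) * sSeries i n)
  rhsSeries≈∑< a {zero}  {N} _   = sym (∑<-zero (suc N) (λ i → zeroʳ (a (suc i))))
  rhsSeries≈∑< a {suc n} {N} n<N = begin
    inner a (suc n) * sign n
      ≡⟨ ≡.cong (_* sign n) (sumA-map-upTo _ (suc n)) ⟩
    ∑< (suc n) (λ i → fromℕ (s (suc n) (suc i)) * a (suc i)) * sign n
      ≈⟨ *-comm _ _ ⟩
    sign n * ∑< (suc n) (λ i → fromℕ (s (suc n) (suc i)) * a (suc i))
      ≈⟨ ∑<-*ˡ (suc n) (sign n) (λ i → fromℕ (s (suc n) (suc i)) * a (suc i)) ⟨
    ∑< (suc n) (λ i → sign n * (fromℕ (s (suc n) (suc i)) * a (suc i)))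
      ≈⟨ ∑<-cong (suc n) (λ {i} _ → *-CS.x∙yz≈z∙yx (sign n) (fromℕ (s (suc n) (suc i))) (a (suc i))) ⟩
    ∑< (suc n) term
      ≈⟨ ∑<-extend (suc n) (N ∸ n) term term-large≈0 ⟨
    ∑< (suc n ℕ.+ (N ∸ n)) term
      ≡⟨ ≡.cong (λ k → ∑< (suc k) term) (ℕₚ.m+[n∸m]≡n (ℕₚ.<⇒≤ n<N)) ⟩
    ∑< (suc N) term
      ∎
    where
    term : ℕ → A
    term i = a (suc i) * sSeries i (suc n)
    term-large≈0 : ∀ i → suc n ≤ i → term i ≈ 0#
    term-large≈0 i n<i = trans (*-congˡ (trans (*-congʳ (fromℕ-s-large n<i)) (zeroˡ _))) (zeroʳ _)

  mul-∑< : ∀ f M (G : ℕ → Series) N →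
           mul f (λ n → ∑< M (λ i → G i n)) N ≈ ∑< M (λ i → mul f (G i) N)
  mul-∑< f zero    G N = trans (mul-comm f _ N) (mul-zeroˡ f (λ _ → refl) N)
  mul-∑< f (suc M) G N = trans (mul-distribˡ f (G 0) (λ n → ∑< M (λ i → G (suc i) n)) N)
                               (+-congˡ (mul-∑< f M (G ∘ suc) N))

proposition2p1 : {c ℓ : Level} (R : CommutativeRing c ℓ) →
    (a : ℕ → CommutativeRing.Carrier R) (N : ℕ) →
    CommutativeRing._≈_ R (PowerSeries.lhs R a N) (PowerSeries.rhs R a N)
proposition2p1 R a N = begin
    lhs a N
      ≈⟨ lhs≈∑< a N ⟩
    ∑< (suc N) (λ i → a (suc i) * lambert (odd i) N)
      ≈⟨ ∑<-cong (suc N) (λ {i} _ → *-congˡ {a (suc i)} (lambert≐inv*sSeries i N)) ⟩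
    ∑< (suc N) (λ i → a (suc i) * mul b (sSeries i) N)
      ≈⟨ ∑<-cong (suc N) (λ {i} _ → mul-*ʳ (a (suc i)) b (sSeries i) N) ⟨
    ∑< (suc N) (λ i → mul b (λ n → a (suc i) * sSeries i n) N)
      ≈⟨ mul-∑< b (suc N) (λ i n → a (suc i) * sSeries i n) N ⟨
    mul b (λ n → ∑< (suc N) (λ i → a (suc i) * sSeries i n)) N
      ≈⟨ mul-cong≤ N (λ _ → refl) (rhsSeries≈∑< a) ⟨
    rhs a N
      ∎
  where
  open CommutativeRing R
  open PowerSeries R
  open SeriesIdentities R
  open import Relation.Binary.Reasoning.Setoid setoid
  b : Series
  b = inv qq²∞
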